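{- Let $\sigma$ be a permutation of $[n]$ and $\psi\in\{\mathtt q,\mathtt s\}^N$. Then there exists a pile assignment $p:[n]\to[N]$ such that the single-round shuffle $(\psi,p)$ transforms the deck $\sigma$ into the identity permutation if and only if the change profile $\Delta(\sigma)$ is accepted by the chain automaton $\Pi(\psi)$.
   Context: Pile shuffle model: a deck of $n$ labelled cards is a permutation $\sigma$ of $[n]$, $\sigma(s)$ being the position from the top of card $s$; sorted means identity. With types $\Sigma=\{\mathtt q,\mathtt s\}$ (queue, stack), one round with type assignment $\psi\in\Sigma^N$ (pile $j$ has type $\psi(j)$) and pile assignment $p:[n]\to[N]$ produces the deck $\tau$ with, for $s\ne t$: $\tau(s)<\tau(t)$ iff $p(s)<p(t)$, or $p(s)=p(t)$, $\psi(p(s))=\mathtt q$ and $\sigma(s)<\sigma(t)$, or $p(s)=p(t)$, $\psi(p(s))=\mathtt s$ and $\sigma(s)>\sigma(t)$ (cards are dealt onto piles in deck order, piles collected in order $1,\dots,N$; queues preserve order, stacks reverse it). Change profile: $\Delta(\sigma)$ is the word $\delta(1)\cdots\delta(n-1)$ over $\{a,d\}$ with $\delta(s)=a$ if $\sigma(s+1)>\sigma(s)$ and $\delta(s)=d$ otherwise. Chain automaton: for $\psi\in\Sigma^N$, $\Pi(\psi)$ is the DFA over $\{a,d\}$ with states $\{1,\dots,N+1\}$, initial state $1$, accepting states $\{1,\dots,N\}$, and transition from state $k\le N$ on letter $c$ to $k+[\psi(k)=\mathtt q\text{ and }c=d]+[\psi(k)=\mathtt s\text{ and }c=a]$ (Iverson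 brackets), state $N+1$ being absorbing. -}

module Defs where

open import Data.Nat using (ℕ; zero; suc; _+_; _<_; _≤_; _∸_)
open import Data.Fin using (Fin; toℕ; fromℕ<)
import Data.Fin as F
open import Data.Fin.Permutation using (Permutation′; _⟨$⟩ʳ_)
open import Data.List using (List; []; _∷_)
open import Data.Product using (_×_)
open import Data.Sum using (_⊎_)
open import Relation.Binary.PropositionalEquality using (_≡_; _≢_)
open import Relation.Nullary using (¬_; yes; no)
import Data.Nat
import Data.List
open import Function.Bundles using (_⇔_)

data PileType : Set where
  q s : PileType

data Letter : Set where
  a d : Letter

-- A deck of n cards: σ s = position (0-based) from the top of card s
Deck : ℕ → Set
Deck n = Permutation′ n

-- τ(s) < τ(t) in the deck produced by one round with types ψ and
-- pile assignment p from deck σ (piles and cards 0-indexed).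
Before : ∀ {n N} → (Fin N → PileType) → (Fin n → Fin N) → Deck n
       → Fin n → Fin n → Set
Before ψ p σ u v =
  (p u F.< p v)
  ⊎ ((p u ≡ p v) × (ψ (p u) ≡ q) × ((σ ⟨$⟩ʳ u) F.< (σ ⟨$⟩ʳ v)))
  ⊎ ((p u ≡ p v) × (ψ (p u) ≡ s) × ((σ ⟨$⟩ʳ v) F.< (σ ⟨$⟩ʳ u)))

-- The single round (ψ , p) transforms σ into the identity deck:
-- the resulting deck τ satisfies τ(u) < τ(v) iff u < v, for u ≠ v.
-- (τ is determined by this relative order, so this says τ = id.)
SortsToIdentity : ∀ {n N} → (Fin N → PileType) → (Fin n → Fin N) → Deck n → Set
SortsToIdentity ψ p σ = ∀ u v → u ≢ v → (Before ψ p σ u v ⇔ (u F.< v))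

-- Change profile Δ(σ) = δ(1) ⋯ δ(n-1) (1-indexed in the paper),
-- δ(s) = a if σ(s+1) > σ(s) and d otherwise.
-- With 0-indexed cards, δ for card pair (i , i+1).
δ : ∀ {n} → Deck (suc n) → Fin n → Letter
δ σ i with (σ ⟨$⟩ʳ F.inject₁ i) F.<? (σ ⟨$⟩ʳ F.suc i)
... | yes _ = a
... | no  _ = d

Δ : ∀ {n} → Deck n → List Letter
Δ {zero}  σ = []
Δ {suc n} σ = Data.List.map (δ σ) (Data.List.allFin n)

-- Chain automaton Π(ψ): states 1 … N+1 (as natural numbers), initial 1,
-- accepting {1,…,N}, N+1 absorbing.
-- step from state k ≤ N reads pile type ψ(k) (pile k, i.e. index k-1).
advance : PileType → Letter → ℕ
advance q d = 1
advance s a = 1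
advance _ _ = 0

step : ∀ {N} → (Fin N → PileType) → ℕ → Letter → ℕ
step {N} ψ zero c = zero   -- unreachable (states start at 1)
step {N} ψ (suc k) c with k Data.Nat.<? N
... | yes k<N = suc k + advance (ψ (fromℕ< k<N)) c
... | no  _   = suc k

run : ∀ {N} → (Fin N → PileType) → ℕ → List Letter → ℕ
run ψ k []       = k
run ψ k (c ∷ w)  = run ψ (step ψ k c) w

Accepts : ∀ {N} → (Fin N → PileType) → List Letter → Set
Accepts {N} ψ w = run ψ 1 w ≤ N

-- A round (ψ, p) deals the cards into the order that is lexicographic in (pile, old position),
-- old positions ascending within a queue and descending within a stack. This order is
-- transitive, so it agrees with the card order as soon as it does on consecutive cards k, k+1:
-- card k+1 goes to a later pile, or to the same pile when δ(k) fits the pile type (an ascent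
-- for a queue, a descent for a stack). That is p(k+1) ≥ p(k) + advance(ψ(p(k)), δ(k)), and
-- the automaton, whose state is 1 + the current pile, computes the least such assignment
-- greedily; an assignment into N piles exists iff this least one never exceeds pile N.
module Submission where

open import Defs
open import Data.Nat using (ℕ; _≤_)
open import Data.Fin using (Fin)
open import Data.Product using (∃)
open import Function.Bundles using (_⇔_)

open import Data.Nat.Base using (zero; suc; _+_; _<_; z≤n; s≤s)
import Data.Nat.Properties as ℕ
open import Data.Fin.Base using (zero; suc; toℕ; inject₁; fromℕ<)
import Data.Fin.Base as F
import Data.Fin.Properties as F
open import Data.Fin.Permutation using (_⟨$⟩ʳ_)
open import Data.List.Base using ([]; _∷_; tabulate)
open import Data.List.Properties using (map-tabulate)
open import Data.Product.Base using (_×_; _,_)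
import Data.Product.Function.Dependent.Propositional as Σ
open import Data.Sum.Base using (_⊎_; inj₁; inj₂; map₂)
import Data.Vec.Functional as Vector
open import Function.Base using (_∘_; _on_; id)
open import Function.Bundles using (Injection; Equivalence; mk⇔)
open import Function.Construct.Identity using (↔-id)
import Function.Properties.Equivalence as ⇔
open import Function.Properties.Inverse using (↔⇒↣)
open import Level using (0ℓ)
open import Relation.Binary.Core using (Rel)
open import Relation.Binary.Definitions using (Transitive; Asymmetric; tri<; tri≈; tri>)
open import Relation.Binary.PropositionalEquality
import Relation.Binary.Reasoning.Setoid as SetoidReasoning
open import Relation.Nullary using (¬_; yes; no; contradiction)

advance≤1 : ∀ t c → advance t c ≤ 1
advance≤1 q a = z≤n
advance≤1 q d = s≤s z≤n
advance≤1 s a = s≤s z≤n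
advance≤1 s d = z≤n

m+advance≤1+m : ∀ m t c → m + advance t c ≤ suc m
m+advance≤1+m m t c = ℕ.≤-trans (ℕ.+-monoʳ-≤ m (advance≤1 t c)) (ℕ.≤-reflexive (ℕ.+-comm m 1))

<-from-adjacent : ∀ {ℓ m} {R : Rel (Fin (suc m)) ℓ} → Transitive R →
                  (∀ k → R (inject₁ k) (suc k)) → ∀ {u v} → u F.< v → R u v
<-from-adjacent {m = suc m}         trans adj {zero}  {suc zero}    _ = adj zero
<-from-adjacent {m = suc m} {R = R} trans adj {zero}  {suc (suc v)} _ =
  trans (adj zero) (<-from-adjacent {R = R on suc} trans (adj ∘ suc) {zero} {suc v} (s≤s z≤n))
<-from-adjacent {m = suc m} {R = R} trans adj {suc u} {suc v} (s≤s u<v) =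
  <-from-adjacent {R = R on suc} trans (adj ∘ suc) u<v

data Change {n} (i j : Fin n) : Letter → Set where
  ascent  : i F.< j → Change i j a
  descent : j F.< i → Change i j d

δ-change : ∀ {m} (σ : Deck (suc m)) (k : Fin m) →
           Change (σ ⟨$⟩ʳ inject₁ k) (σ ⟨$⟩ʳ suc k) (δ σ k)
δ-change σ k with (σ ⟨$⟩ʳ inject₁ k) F.<? (σ ⟨$⟩ʳ suc k)
... | yes lt = ascent lt
... | no ¬lt = descent (ℕ.≤∧≢⇒< (ℕ.≮⇒≥ ¬lt) σ[k+1]≢σ[k])
  where
  σ[k+1]≢σ[k] : toℕ (σ ⟨$⟩ʳ suc k) ≢ toℕ (σ ⟨$⟩ʳ inject₁ k)
  σ[k+1]≢σ[k] = F.<⇒≢ (F.≤̄⇒inject₁< F.≤-refl)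
              ∘ sym ∘ Injection.injective (↔⇒↣ σ) ∘ F.toℕ-injective

module _ {N : ℕ} (ψ : Fin N → PileType) where

  -- Before ψ p σ u v unfolds to DealOrder (p u , σ ⟨$⟩ʳ u) (p v , σ ⟨$⟩ʳ v).
  DealOrder : ∀ {n} → Rel (Fin N × Fin n) 0ℓ
  DealOrder (x , i) (y , j) =
    x F.< y ⊎ (x ≡ y × ψ x ≡ q × i F.< j) ⊎ (x ≡ y × ψ x ≡ s × j F.< i)

  DealOrder-trans : ∀ {n} → Transitive (DealOrder {n})
  DealOrder-trans (inj₁ x<y) (inj₁ y<z) = inj₁ (F.<-trans x<y y<z)
  DealOrder-trans (inj₁ x<y) (inj₂ (inj₁ (refl , _))) = inj₁ x<y
  DealOrder-trans (inj₁ x<y) (inj₂ (inj₂ (refl , _))) = inj₁ x<y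
  DealOrder-trans (inj₂ (inj₁ (refl , _))) (inj₁ y<z) = inj₁ y<z
  DealOrder-trans (inj₂ (inj₂ (refl , _))) (inj₁ y<z) = inj₁ y<z
  DealOrder-trans (inj₂ (inj₁ (refl , ψx≡q , i<j))) (inj₂ (inj₁ (refl , _ , j<k))) =
    inj₂ (inj₁ (refl , ψx≡q , F.<-trans i<j j<k))
  DealOrder-trans (inj₂ (inj₂ (refl , ψx≡s , j<i))) (inj₂ (inj₂ (refl , _ , k<j))) =
    inj₂ (inj₂ (refl , ψx≡s , F.<-trans k<j j<i))
  DealOrder-trans (inj₂ (inj₁ (refl , ψx≡q , _))) (inj₂ (inj₂ (refl , ψx≡s , _))) =
    contradiction (trans (sym ψx≡q) ψx≡s) λ ()
  DealOrder-trans (inj₂ (inj₂ (refl , ψx≡s , _))) (inj₂ (inj₁ (refl , ψx≡q , _))) =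
    contradiction (trans (sym ψx≡q) ψx≡s) λ ()

  DealOrder-irrefl : ∀ {n} {xi : Fin N × Fin n} → ¬ DealOrder xi xi
  DealOrder-irrefl (inj₁ x<x)                  = F.<-irrefl refl x<x
  DealOrder-irrefl (inj₂ (inj₁ (_ , _ , i<i))) = F.<-irrefl refl i<i
  DealOrder-irrefl (inj₂ (inj₂ (_ , _ , i<i))) = F.<-irrefl refl i<i

  DealOrder-asym : ∀ {n} → Asymmetric (DealOrder {n})
  DealOrder-asym xi<yj yj<xi = DealOrder-irrefl (DealOrder-trans xi<yj yj<xi)

  DealOrder⇔advance≤ : ∀ {n} {x y : Fin N} {i j : Fin n} {c} → Change i j c →
                       DealOrder (x , i) (y , j) ⇔ toℕ x + advance (ψ x) c ≤ toℕ y
  DealOrder⇔advance≤ {x = x} {y} {i} {j} {c} ch = mk⇔ (to ch) (from ch)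
    where
    stay-or-move : toℕ x + 0 ≤ toℕ y → x F.< y ⊎ x ≡ y
    stay-or-move x≤y = map₂ F.toℕ-injective
      (ℕ.m≤n⇒m<n∨m≡n (subst (_≤ toℕ y) (ℕ.+-identityʳ (toℕ x)) x≤y))
    move : toℕ x + 1 ≤ toℕ y → x F.< y
    move = subst (_≤ toℕ y) (ℕ.+-comm (toℕ x) 1)
    to : Change i j c → DealOrder (x , i) (y , j) → toℕ x + advance (ψ x) c ≤ toℕ y
    to _ (inj₁ x<y) = ℕ.≤-trans (m+advance≤1+m (toℕ x) (ψ x) c) x<y
    to (ascent _)    (inj₂ (inj₁ (refl , ψx≡q , _)))   rewrite ψx≡q = ℕ.≤-reflexive (ℕ.+-identityʳ _)
    to (descent j<i) (inj₂ (inj₁ (refl , _ , i<j)))    = contradiction j<i (F.<-asym i<j)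
    to (ascent i<j)  (inj₂ (inj₂ (refl , _ , j<i)))    = contradiction j<i (F.<-asym i<j)
    to (descent _)   (inj₂ (inj₂ (refl , ψx≡s , _)))   rewrite ψx≡s = ℕ.≤-reflexive (ℕ.+-identityʳ _)
    from : Change i j c → toℕ x + advance (ψ x) c ≤ toℕ y → DealOrder (x , i) (y , j)
    from ch x+adv≤y with ψ x | ch
    ... | q | ascent i<j  = map₂ (λ x≡y → inj₁ (x≡y , refl , i<j)) (stay-or-move x+adv≤y)
    ... | q | descent _   = inj₁ (move x+adv≤y)
    ... | s | ascent _    = inj₁ (move x+adv≤y)
    ... | s | descent j<i = map₂ (λ x≡y → inj₂ (x≡y , refl , j<i)) (stay-or-move x+adv≤y)

module _ {N : ℕ} (ψ : Fin N → PileType) where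

  Admissible : ∀ {m} → (Fin m → Letter) → (Fin (suc m) → Fin N) → Set
  Admissible w p = ∀ k → toℕ (p (inject₁ k)) + advance (ψ (p (inject₁ k))) (w k) ≤ toℕ (p (suc k))

  step-inflationary : ∀ z c → z ≤ step ψ z c
  step-inflationary zero    c = z≤n
  step-inflationary (suc k) c with k ℕ.<? N
  ... | yes _ = ℕ.m≤m+n (suc k) _
  ... | no  _ = ℕ.≤-refl

  step-≤suc : ∀ z c → step ψ z c ≤ suc z
  step-≤suc zero    c = z≤n
  step-≤suc (suc k) c with k ℕ.<? N
  ... | yes _ = s≤s (m+advance≤1+m k _ c)
  ... | no  _ = ℕ.n≤1+n (suc k)

  step-fromℕ< : ∀ {k} c (k<N : k < N) → step ψ (suc k) c ≡ suc (k + advance (ψ (fromℕ< k<N)) c)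
  step-fromℕ< {k} c k<N with k ℕ.<? N
  ... | yes _   = refl
  ... | no  k≮N = contradiction k<N k≮N

  run-inflationary : ∀ z w → z ≤ run ψ z w
  run-inflationary z []      = ℕ.≤-refl
  run-inflationary z (c ∷ w) = ℕ.≤-trans (step-inflationary z c) (run-inflationary (step ψ z c) w)

  step-bounded : ∀ {x y : Fin N} {c} z → z ≤ suc (toℕ x) →
                 toℕ x + advance (ψ x) c ≤ toℕ y → step ψ z c ≤ suc (toℕ y)
  step-bounded zero _ _ = z≤n
  step-bounded {x} {y} {c} (suc k) (s≤s k≤x) x+adv≤y with ℕ.m≤n⇒m<n∨m≡n k≤x
  ... | inj₁ k<x  = ℕ.≤-trans (step-≤suc (suc k) c)
                              (s≤s (ℕ.≤-trans k<x (ℕ.≤-trans (ℕ.m≤m+n _ _) x+adv≤y)))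
  ... | inj₂ refl = begin
    step ψ (suc (toℕ x)) c                             ≡⟨ step-fromℕ< c (F.toℕ<n x) ⟩
    suc (toℕ x + advance (ψ (fromℕ< (F.toℕ<n x))) c)   ≡⟨ cong (λ x′ → suc (toℕ x + advance (ψ x′) c))
                                                                (F.fromℕ<-toℕ x (F.toℕ<n x)) ⟩
    suc (toℕ x + advance (ψ x) c)                      ≤⟨ s≤s x+adv≤y ⟩
    suc (toℕ y)                                        ∎
    where open ℕ.≤-Reasoning

  admissible⇒run≤ : ∀ {m} (w : Fin m → Letter) (p : Fin (suc m) → Fin N) → Admissible w p →
                    ∀ z → z ≤ suc (toℕ (p zero)) → run ψ z (tabulate w) ≤ N
  admissible⇒run≤ {zero}  w p _   z z≤ = ℕ.≤-trans z≤ (F.toℕ<n (p zero))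
  admissible⇒run≤ {suc m} w p adm z z≤ =
    admissible⇒run≤ (w ∘ suc) (p ∘ suc) (adm ∘ suc) (step ψ z (w zero)) (step-bounded z z≤ (adm zero))

  run≤⇒admissible : ∀ {m} (w : Fin m → Letter) k → run ψ (suc k) (tabulate w) ≤ N →
                    ∃ λ (p : Fin (suc m) → Fin N) → toℕ (p zero) ≡ k × Admissible w p
  run≤⇒admissible {zero}  w k k<N   = (λ _ → fromℕ< k<N) , F.toℕ-fromℕ< k<N , λ ()
  run≤⇒admissible {suc m} w k run≤N = extend (run≤⇒admissible (w ∘ suc) k′ run′≤N)
    where
    k<N : k < N
    k<N = ℕ.≤-trans (run-inflationary (suc k) (tabulate w)) run≤N
    x : Fin N
    x = fromℕ< k<N
    k′ : ℕ
    k′ = k + advance (ψ x) (w zero)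
    run′≤N : run ψ (suc k′) (tabulate (w ∘ suc)) ≤ N
    run′≤N = subst (λ z → run ψ z (tabulate (w ∘ suc)) ≤ N) (step-fromℕ< (w zero) k<N) run≤N
    extend : (∃ λ p → toℕ (p zero) ≡ k′ × Admissible (w ∘ suc) p) →
             (∃ λ p → toℕ (p zero) ≡ k × Admissible w p)
    extend (p , p₀≡k′ , adm) = x Vector.∷ p , F.toℕ-fromℕ< k<N , λ
      { zero    → ℕ.≤-reflexive (trans (cong (_+ advance (ψ x) (w zero)) (F.toℕ-fromℕ< k<N)) (sym p₀≡k′))
      ; (suc i) → adm i }

  accepts⇔admissible : ∀ {m} (w : Fin m → Letter) → Accepts ψ (tabulate w) ⇔ ∃ (Admissible w)
  accepts⇔admissible w = mk⇔
    (λ accepts → let p , _ , adm = run≤⇒admissible w 0 accepts in p , adm)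
    (λ (p , adm) → admissible⇒run≤ w p adm 1 (s≤s z≤n))

sorts⇔admissible : ∀ {N m} (ψ : Fin N → PileType) (σ : Deck (suc m)) p →
                   SortsToIdentity ψ p σ ⇔ Admissible ψ (δ σ) p
sorts⇔admissible ψ σ p = mk⇔ sorts⇒admissible admissible⇒sorts
  where
  adjacent⇔ : ∀ k → Before ψ p σ (inject₁ k) (suc k) ⇔
              toℕ (p (inject₁ k)) + advance (ψ (p (inject₁ k))) (δ σ k) ≤ toℕ (p (suc k))
  adjacent⇔ k = DealOrder⇔advance≤ ψ (δ-change σ k)
  sorts⇒admissible : SortsToIdentity ψ p σ → Admissible ψ (δ σ) p
  sorts⇒admissible sorts k =
    Equivalence.to (adjacent⇔ k) (Equivalence.from (sorts _ _ (F.<⇒≢ k<k+1)) k<k+1)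
    where
    k<k+1 : inject₁ k F.< suc k
    k<k+1 = F.≤̄⇒inject₁< F.≤-refl
  admissible⇒sorts : Admissible ψ (δ σ) p → SortsToIdentity ψ p σ
  admissible⇒sorts adm u v u≢v = mk⇔ to from
    where
    from : ∀ {u v} → u F.< v → Before ψ p σ u v
    from = <-from-adjacent {R = Before ψ p σ} (DealOrder-trans ψ)
                           (λ k → Equivalence.from (adjacent⇔ k) (adm k))
    to : Before ψ p σ u v → u F.< v
    to before with F.<-cmp u v
    ... | tri< u<v _ _ = u<v
    ... | tri≈ _ u≡v _ = contradiction u≡v u≢v
    ... | tri> _ _ v<u = contradiction (from v<u) (DealOrder-asym ψ before)

Δ≡tabulate : ∀ {m} (σ : Deck (suc m)) → Δ σ ≡ tabulate (δ σ)
Δ≡tabulate σ = map-tabulate id (δ σ)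

proposition1 : ∀ (n N : ℕ) → 1 ≤ n → (σ : Deck n) → (ψ : Fin N → PileType)
    → (∃ λ (p : Fin n → Fin N) → SortsToIdentity ψ p σ) ⇔ Accepts ψ (Δ σ)
proposition1 zero    N () σ ψ
proposition1 (suc m) N _  σ ψ = begin
  (∃ λ p → SortsToIdentity ψ p σ)  ≈⟨ Σ.cong (↔-id _) (sorts⇔admissible ψ σ _) ⟩
  (∃ λ p → Admissible ψ (δ σ) p)   ≈⟨ ⇔.sym (accepts⇔admissible ψ (δ σ)) ⟩
  Accepts ψ (tabulate (δ σ))        ≡⟨ cong (Accepts ψ) (sym (Δ≡tabulate σ)) ⟩
  Accepts ψ (Δ σ)                   ∎
  where open SetoidReasoning (⇔.⇔-setoid 0ℓ)
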